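{- Let $p\geqslant 2$ be an integer and let $\theta$ be a quantifier-free sentence in the language $\{0,S,+,V_p\}$. If $\theta$ holds in the standard model $(\mathbb N,S,+,0,V_p)$, then $\mathsf{T_{BA}}_p\vdash\theta$; otherwise $\mathsf{T_{BA}}_p\vdash\neg\theta$.
   Context: Fix an integer $p \geqslant 2$. The language consists of a constant $0$, a unary function symbol $S$, a binary function symbol $+$ and a unary function symbol $V_p$. In the standard model $(\mathbb N, S, +, 0, V_p)$, $S(n)=n+1$, $+$ is addition, $V_p(0)=0$ and, for $n>0$, $V_p(n)=p^k$ where $p^k \mid n$ and $p^{k+1}\nmid n$. For $n\in\mathbb N$, $\underline n$ denotes the numeral $S^n(0)$; for a positive integer $n$ and a term $t$, $n t$ denotes the term $(\dots((t+t)+t)\dots)$ with $n$ occurrences of $t$. Iterated exponentials are defined by $2^k_0=k$, $2^k_{m+1}=2^{2^k_m}$. For a formula $\varphi$, $|\varphi|$ is its length (number of symbols). $x \leqslant y$ abbreviates $\exists z\,(x+z=y)$ for a fresh variable $z$, and $\exists x \leqslant t\, \varphi$ abbreviates $\exists x\,(x\leqslant t \wedge \varphi)$. The theory $\mathsf{T_{BA}}_p$ consists of the (universal closures of the) axioms: (S0) $Sx=Sy\to x=y$; (S1) $0\ne Sx$; (S2) $x=0\vee\exists y\,(x=Sy)$; (A0) $x+0=x$; (A1) $x+Sy=S(x+y)$; (V0) $V_p(0)=0$; (V1) $V_p(\underline 1)=\underline 1$; (V2) $V_p(p x)=p V_p(x)$; (V3) $\bigwedge_{i=1}^{p-1} V_p(p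 x+\underline i)=\underline 1$; and, for each formula $\varphi(x)$ with exactly one free variable, (Bound$_\varphi$) $\exists x\,\varphi(x)\to\exists x\leqslant \underline{n_\varphi}\,\varphi(x)$, where $n_\varphi=p^{2^3_{|\varphi|}}$. -}

module Defs where

open import Data.Nat using (ℕ; zero; suc; _+_; _*_; _^_; _≤_)
open import Data.Nat.Divisibility using (_∣_; _∣?_; divides)
open import Data.Nat.Properties using (_≟_)
open import Data.List using (List; []; _∷_; map)
open import Data.List.Membership.Propositional using (_∈_)
open import Data.List.Relation.Unary.All using (All)
open import Data.Product using (Σ; _×_; ∃)
open import Data.Sum using (_⊎_)
open import Data.Empty using (⊥)
open import Relation.Nullary using (¬_; yes; no)
open import Relation.Binary.PropositionalEquality using (_≡_)

-- Syntax of the language {0, S, +, V_p}, first-order logic with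
-- equality; variables are de Bruijn indices (var 0 = innermost bound).

infixl 8 _⊕_
infix  7 _≐_
infixr 3 _⇒_
infixr 4 _∨'_
infixr 5 _∧'_

data Term : Set where
  var  : ℕ → Term
  zer  : Term
  S    : Term → Term
  _⊕_  : Term → Term → Term
  V    : Term → Term

data Formula : Set where
  _≐_  : Term → Term → Formula
  ¬'_  : Formula → Formula
  _∧'_ : Formula → Formula → Formula
  _∨'_ : Formula → Formula → Formula
  _⇒_  : Formula → Formula → Formula
  ∀'   : Formula → Formula
  ∃'   : Formula → Formula

num : ℕ → Term
num zero    = zer
num (suc n) = S (num n)

-- n t = (...((t+t)+t)...) with n occurrences of t  (n ≥ 1; the value
-- at n = 0 is an unused junk value)
mulT : ℕ → Term → Term
mulT zero          t = t
mulT (suc zero)    t = t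
mulT (suc (suc n)) t = mulT (suc n) t ⊕ t

-- Each function/relation symbol, connective
-- and variable occurrence counts 1; a quantifier prefix "∃x"/"∀x"
-- counts 2 (quantifier + variable).  Parentheses are not counted.

lenT : Term → ℕ
lenT (var _) = 1
lenT zer     = 1
lenT (S t)   = suc (lenT t)
lenT (t ⊕ u) = suc (lenT t + lenT u)
lenT (V t)   = suc (lenT t)

len : Formula → ℕ
len (t ≐ u)  = suc (lenT t + lenT u)
len (¬' φ)   = suc (len φ)
len (φ ∧' ψ) = suc (len φ + len ψ)
len (φ ∨' ψ) = suc (len φ + len ψ)
len (φ ⇒ ψ)  = suc (len φ + len ψ)
len (∀' φ)   = 2 + len φ
len (∃' φ)   = 2 + len φ

data FreeT (k : ℕ) : Term → Set where
  fvar : FreeT k (var k)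
  fS   : ∀ {t} → FreeT k t → FreeT k (S t)
  f⊕ˡ  : ∀ {t u} → FreeT k t → FreeT k (t ⊕ u)
  f⊕ʳ  : ∀ {t u} → FreeT k u → FreeT k (t ⊕ u)
  fV   : ∀ {t} → FreeT k t → FreeT k (V t)

data Free : ℕ → Formula → Set where
  f≐ˡ : ∀ {k t u} → FreeT k t → Free k (t ≐ u)
  f≐ʳ : ∀ {k t u} → FreeT k u → Free k (t ≐ u)
  f¬  : ∀ {k φ} → Free k φ → Free k (¬' φ)
  f∧ˡ : ∀ {k φ ψ} → Free k φ → Free k (φ ∧' ψ)
  f∧ʳ : ∀ {k φ ψ} → Free k ψ → Free k (φ ∧' ψ)
  f∨ˡ : ∀ {k φ ψ} → Free k φ → Free k (φ ∨' ψ)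
  f∨ʳ : ∀ {k φ ψ} → Free k ψ → Free k (φ ∨' ψ)
  f⇒ˡ : ∀ {k φ ψ} → Free k φ → Free k (φ ⇒ ψ)
  f⇒ʳ : ∀ {k φ ψ} → Free k ψ → Free k (φ ⇒ ψ)
  f∀  : ∀ {k φ} → Free (suc k) φ → Free k (∀' φ)
  f∃  : ∀ {k φ} → Free (suc k) φ → Free k (∃' φ)

Sentence : Formula → Set
Sentence φ = ∀ k → ¬ Free k φ

OneFree : Formula → Set
OneFree φ = Free 0 φ × (∀ k → Free k φ → k ≡ 0)

data QF : Formula → Set where
  qf≐ : ∀ {t u} → QF (t ≐ u)
  qf¬ : ∀ {φ} → QF φ → QF (¬' φ)
  qf∧ : ∀ {φ ψ} → QF φ → QF ψ → QF (φ ∧' ψ)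
  qf∨ : ∀ {φ ψ} → QF φ → QF ψ → QF (φ ∨' ψ)
  qf⇒ : ∀ {φ ψ} → QF φ → QF ψ → QF (φ ⇒ ψ)

extR : (ℕ → ℕ) → ℕ → ℕ
extR ρ zero    = zero
extR ρ (suc n) = suc (ρ n)

renT : (ℕ → ℕ) → Term → Term
renT ρ (var n) = var (ρ n)
renT ρ zer     = zer
renT ρ (S t)   = S (renT ρ t)
renT ρ (t ⊕ u) = renT ρ t ⊕ renT ρ u
renT ρ (V t)   = V (renT ρ t)

ren : (ℕ → ℕ) → Formula → Formula
ren ρ (t ≐ u)  = renT ρ t ≐ renT ρ u
ren ρ (¬' φ)   = ¬' ren ρ φ
ren ρ (φ ∧' ψ) = ren ρ φ ∧' ren ρ ψ
ren ρ (φ ∨' ψ) = ren ρ φ ∨' ren ρ ψ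
ren ρ (φ ⇒ ψ)  = ren ρ φ ⇒ ren ρ ψ
ren ρ (∀' φ)   = ∀' (ren (extR ρ) φ)
ren ρ (∃' φ)   = ∃' (ren (extR ρ) φ)

shift : Formula → Formula
shift = ren suc

extS : (ℕ → Term) → ℕ → Term
extS σ zero    = var zero
extS σ (suc n) = renT suc (σ n)

subT : (ℕ → Term) → Term → Term
subT σ (var n) = σ n
subT σ zer     = zer
subT σ (S t)   = S (subT σ t)
subT σ (t ⊕ u) = subT σ t ⊕ subT σ u
subT σ (V t)   = V (subT σ t)

sub : (ℕ → Term) → Formula → Formula
sub σ (t ≐ u)  = subT σ t ≐ subT σ u
sub σ (¬' φ)   = ¬' sub σ φ
sub σ (φ ∧' ψ) = sub σ φ ∧' sub σ ψ
sub σ (φ ∨' ψ) = sub σ φ ∨' sub σ ψ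
sub σ (φ ⇒ ψ)  = sub σ φ ⇒ sub σ ψ
sub σ (∀' φ)   = ∀' (sub (extS σ) φ)
sub σ (∃' φ)   = ∃' (sub (extS σ) φ)

-- φ[t/var 0], lowering the other free variables by one
single : Term → ℕ → Term
single t zero    = t
single t (suc n) = var n

_[_] : Formula → Term → Formula
φ [ t ] = sub (single t) φ

infix 2 _⊢_

data _⊢_ (Γ : List Formula) : Formula → Set where
  assum : ∀ {φ} → φ ∈ Γ → Γ ⊢ φ
  ∧I    : ∀ {φ ψ} → Γ ⊢ φ → Γ ⊢ ψ → Γ ⊢ φ ∧' ψ
  ∧E₁   : ∀ {φ ψ} → Γ ⊢ φ ∧' ψ → Γ ⊢ φ
  ∧E₂   : ∀ {φ ψ} → Γ ⊢ φ ∧' ψ → Γ ⊢ ψ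
  ∨I₁   : ∀ {φ ψ} → Γ ⊢ φ → Γ ⊢ φ ∨' ψ
  ∨I₂   : ∀ {φ ψ} → Γ ⊢ ψ → Γ ⊢ φ ∨' ψ
  ∨E    : ∀ {φ ψ χ} → Γ ⊢ φ ∨' ψ → (φ ∷ Γ) ⊢ χ → (ψ ∷ Γ) ⊢ χ → Γ ⊢ χ
  ⇒I    : ∀ {φ ψ} → (φ ∷ Γ) ⊢ ψ → Γ ⊢ φ ⇒ ψ
  ⇒E    : ∀ {φ ψ} → Γ ⊢ φ ⇒ ψ → Γ ⊢ φ → Γ ⊢ ψ
  ¬I    : ∀ {φ ψ} → (φ ∷ Γ) ⊢ ψ → (φ ∷ Γ) ⊢ ¬' ψ → Γ ⊢ ¬' φ
  ¬E    : ∀ {φ ψ} → Γ ⊢ φ → Γ ⊢ ¬' φ → Γ ⊢ ψ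
  ¬¬E   : ∀ {φ} → Γ ⊢ ¬' (¬' φ) → Γ ⊢ φ
  ∀I    : ∀ {φ} → map shift Γ ⊢ φ → Γ ⊢ ∀' φ
  ∀E    : ∀ {φ} (t : Term) → Γ ⊢ ∀' φ → Γ ⊢ φ [ t ]
  ∃I    : ∀ {φ} (t : Term) → Γ ⊢ φ [ t ] → Γ ⊢ ∃' φ
  ∃E    : ∀ {φ ψ} → Γ ⊢ ∃' φ → (φ ∷ map shift Γ) ⊢ shift ψ → Γ ⊢ ψ
  ≐refl : ∀ (t : Term) → Γ ⊢ t ≐ t
  ≐subst : ∀ {t u} (φ : Formula) → Γ ⊢ t ≐ u → Γ ⊢ φ [ t ] → Γ ⊢ φ [ u ]

_⊩_ : (Formula → Set) → Formula → Set
T ⊩ φ = Σ (List Formula) λ Δ → All T Δ × (Δ ⊢ φ)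

tower : ℕ → ℕ → ℕ
tower k zero    = k
tower k (suc m) = 2 ^ tower k m

bound : ℕ → Formula → ℕ
bound p φ = p ^ tower 3 (len φ)

-- ∃x (x ≤ n̲ ∧ φ(x)), where x ≤ t abbreviates ∃z (x + z = t)
∃≤ : ℕ → Formula → Formula
∃≤ n φ = ∃' ((∃' (var 1 ⊕ var 0 ≐ num n)) ∧' φ)

v3body : ℕ → ℕ → Formula
v3body p zero          = V (mulT p (var 0) ⊕ num 1) ≐ num 1
v3body p (suc zero)    = V (mulT p (var 0) ⊕ num 1) ≐ num 1
v3body p (suc (suc k)) = v3body p (suc k) ∧' (V (mulT p (var 0) ⊕ num (suc (suc k))) ≐ num 1)

data TBA (p : ℕ) : Formula → Set where
  axS0 : TBA p (∀' (∀' (S (var 1) ≐ S (var 0) ⇒ var 1 ≐ var 0)))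
  axS1 : TBA p (∀' (¬' (zer ≐ S (var 0))))
  axS2 : TBA p (∀' (var 0 ≐ zer ∨' ∃' (var 1 ≐ S (var 0))))
  axA0 : TBA p (∀' (var 0 ⊕ zer ≐ var 0))
  axA1 : TBA p (∀' (∀' (var 1 ⊕ S (var 0) ≐ S (var 1 ⊕ var 0))))
  axV0 : TBA p (V zer ≐ zer)
  axV1 : TBA p (V (num 1) ≐ num 1)
  axV2 : TBA p (∀' (V (mulT p (var 0)) ≐ mulT p (V (var 0))))
  axV3 : TBA p (∀' (v3body p (p Data.Nat.∸ 1)))
  axBound : ∀ φ → OneFree φ → TBA p (∃' φ ⇒ ∃≤ (bound p φ) φ)

-- V_p(0) = 0 and V_p(n) = p^k with p^k ∣ n, p^(k+1) ∤ n for n > 0;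
-- computed by repeatedly dividing by p (fuel n+1 suffices for p ≥ 2).
vpAux : ℕ → ℕ → ℕ → ℕ
vpAux p zero       n = 1
vpAux p (suc fuel) n with n ≟ 0
... | yes _ = 0
... | no  _ with p ∣? n
...   | yes (divides q _) = p * vpAux p fuel q
...   | no  _ = 1

vp : ℕ → ℕ → ℕ
vp p n = vpAux p (suc n) n

_∷ₑ_ : ℕ → (ℕ → ℕ) → ℕ → ℕ
(a ∷ₑ ρ) zero    = a
(a ∷ₑ ρ) (suc n) = ρ n

evalT : ℕ → (ℕ → ℕ) → Term → ℕ
evalT p ρ (var n) = ρ n
evalT p ρ zer     = 0
evalT p ρ (S t)   = suc (evalT p ρ t)
evalT p ρ (t ⊕ u) = evalT p ρ t + evalT p ρ u
evalT p ρ (V t)   = vp p (evalT p ρ t)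

Sat : ℕ → (ℕ → ℕ) → Formula → Set
Sat p ρ (t ≐ u)  = evalT p ρ t ≡ evalT p ρ u
Sat p ρ (¬' φ)   = ¬ Sat p ρ φ
Sat p ρ (φ ∧' ψ) = Sat p ρ φ × Sat p ρ ψ
Sat p ρ (φ ∨' ψ) = Sat p ρ φ ⊎ Sat p ρ ψ
Sat p ρ (φ ⇒ ψ)  = Sat p ρ φ → Sat p ρ ψ
Sat p ρ (∀' φ)   = ∀ (a : ℕ) → Sat p (a ∷ₑ ρ) φ
Sat p ρ (∃' φ)   = ∃ λ (a : ℕ) → Sat p (a ∷ₑ ρ) φ

-- truth of a sentence in the standard model (environment irrelevant)
StdTrue : ℕ → Formula → Set
StdTrue p φ = Sat p (λ _ → 0) φ

-- Every closed term t is provably equal to the numeral of its value: S and +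
-- are evaluated by A0 and A1, and V_p(n̲) by recursion on n, using V0 at 0,
-- V2 when p ∣ n (n = p q with q < n) and V3 when n = p q + r with 0 < r < p.
-- Distinct numerals are provably distinct by S0 and S1, so every atomic
-- sentence is proved or refuted according to its truth, and this is
-- propagated through the connectives by propositional reasoning.
module Submission where

open import Defs
open import Data.Nat using (ℕ; zero; suc; _+_; _*_; _∸_; _≤_; _<_; z≤n; s≤s; NonZero; >-nonZero; ≢-nonZero)
open import Data.Nat.Properties using (_≟_; +-identityʳ; +-suc; +-comm; *-comm; ≤-pred; ≤-refl; m≤n⇒m<n∨m≡n; <-≤-trans; <-trans; m<m*n; n≢0⇒n>0; ∸-monoˡ-≤)
open import Data.Nat.DivMod using (_/_; _%_; m≡m%n+[m/n]*n; m%n<n)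
open import Data.Nat.Divisibility using (_∣?_; divides)
open import Data.List using (List; []; _∷_; map)
open import Data.List.Relation.Unary.Any using (here; there)
open import Data.List.Relation.Unary.All using (All; []; _∷_)
open import Data.List.Relation.Binary.Subset.Propositional using (_⊆_)
open import Data.List.Relation.Binary.Subset.Propositional.Properties using (∷⁺ʳ; map⁺)
open import Data.Product using (Σ; _×_; _,_; proj₁; proj₂)
open import Data.Sum using (_⊎_; inj₁; inj₂; [_,_]; [_,_]′)
open import Data.Empty using (⊥-elim)
open import Function using (_∘_; const)
open import Relation.Nullary using (¬_; Dec; yes; no; contradiction)
open import Relation.Binary.Bundles using (Setoid)
open import Relation.Binary.PropositionalEquality using (_≡_; _≢_; refl; sym; trans; cong; cong₂; subst; subst₂)
import Relation.Binary.Reasoning.Setoid as SetoidReasoning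

private
  variable
    Γ Γ' : List Formula
    φ ψ : Formula
    t t' u u' : Term

weaken : Γ ⊆ Γ' → Γ ⊢ φ → Γ' ⊢ φ
weaken Γ⊆Γ' (assum φ∈Γ)    = assum (Γ⊆Γ' φ∈Γ)
weaken Γ⊆Γ' (∧I d e)       = ∧I (weaken Γ⊆Γ' d) (weaken Γ⊆Γ' e)
weaken Γ⊆Γ' (∧E₁ d)        = ∧E₁ (weaken Γ⊆Γ' d)
weaken Γ⊆Γ' (∧E₂ d)        = ∧E₂ (weaken Γ⊆Γ' d)
weaken Γ⊆Γ' (∨I₁ d)        = ∨I₁ (weaken Γ⊆Γ' d)
weaken Γ⊆Γ' (∨I₂ d)        = ∨I₂ (weaken Γ⊆Γ' d)
weaken Γ⊆Γ' (∨E d e f)     = ∨E (weaken Γ⊆Γ' d) (weaken (∷⁺ʳ _ Γ⊆Γ') e) (weaken (∷⁺ʳ _ Γ⊆Γ') f)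
weaken Γ⊆Γ' (⇒I d)         = ⇒I (weaken (∷⁺ʳ _ Γ⊆Γ') d)
weaken Γ⊆Γ' (⇒E d e)       = ⇒E (weaken Γ⊆Γ' d) (weaken Γ⊆Γ' e)
weaken Γ⊆Γ' (¬I d e)       = ¬I (weaken (∷⁺ʳ _ Γ⊆Γ') d) (weaken (∷⁺ʳ _ Γ⊆Γ') e)
weaken Γ⊆Γ' (¬E d e)       = ¬E (weaken Γ⊆Γ' d) (weaken Γ⊆Γ' e)
weaken Γ⊆Γ' (¬¬E d)        = ¬¬E (weaken Γ⊆Γ' d)
weaken Γ⊆Γ' (∀I d)         = ∀I (weaken (map⁺ shift Γ⊆Γ') d)
weaken Γ⊆Γ' (∀E t d)       = ∀E t (weaken Γ⊆Γ' d)
weaken Γ⊆Γ' (∃I t d)       = ∃I t (weaken Γ⊆Γ' d)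
weaken Γ⊆Γ' (∃E d e)       = ∃E (weaken Γ⊆Γ' d) (weaken (∷⁺ʳ _ (map⁺ shift Γ⊆Γ')) e)
weaken Γ⊆Γ' (≐refl t)      = ≐refl t
weaken Γ⊆Γ' (≐subst φ d e) = ≐subst φ (weaken Γ⊆Γ' d) (weaken Γ⊆Γ' e)

weaken-∷ : Γ ⊢ φ → (ψ ∷ Γ) ⊢ φ
weaken-∷ = weaken there

hypothesis : (φ ∷ Γ) ⊢ φ
hypothesis = assum (here refl)

subT-single-renT-suc : ∀ u t → subT (single u) (renT suc t) ≡ t
subT-single-renT-suc u (var n)  = refl
subT-single-renT-suc u zer      = refl
subT-single-renT-suc u (S t)    = cong S (subT-single-renT-suc u t)
subT-single-renT-suc u (t ⊕ t') = cong₂ _⊕_ (subT-single-renT-suc u t) (subT-single-renT-suc u t')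
subT-single-renT-suc u (V t)    = cong V (subT-single-renT-suc u t)

subT-num : ∀ σ n → subT σ (num n) ≡ num n
subT-num σ zero    = refl
subT-num σ (suc n) = cong S (subT-num σ n)

subT-mulT : ∀ σ n t → subT σ (mulT n t) ≡ mulT n (subT σ t)
subT-mulT σ zero          t = refl
subT-mulT σ (suc zero)    t = refl
subT-mulT σ (suc (suc n)) t = cong (_⊕ subT σ t) (subT-mulT σ (suc n) t)

-- The equality rules are instances of ≐subst at a formula whose fixed side is
-- shifted, so that substituting for var 0 gives it back (subT-single-renT-suc).
≐-sym : Γ ⊢ t ≐ u → Γ ⊢ u ≐ t
≐-sym {Γ} {t} {u} t≐u =
  subst (λ t″ → Γ ⊢ u ≐ t″) (subT-single-renT-suc u t)
    (≐subst (var 0 ≐ renT suc t) t≐u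
      (subst (λ t″ → Γ ⊢ t ≐ t″) (sym (subT-single-renT-suc t t)) (≐refl t)))

≐-trans : Γ ⊢ t ≐ u → Γ ⊢ u ≐ u' → Γ ⊢ t ≐ u'
≐-trans {Γ} {t} {u} {u'} t≐u u≐u' =
  subst (λ t″ → Γ ⊢ t″ ≐ u') (subT-single-renT-suc u' t)
    (≐subst (renT suc t ≐ var 0) u≐u'
      (subst (λ t″ → Γ ⊢ t″ ≐ u) (sym (subT-single-renT-suc u t)) t≐u))

≐-setoid : List Formula → Setoid _ _
≐-setoid Γ = record
  { Carrier       = Term
  ; _≈_           = λ t u → Γ ⊢ t ≐ u
  ; isEquivalence = record { refl = ≐refl _ ; sym = ≐-sym ; trans = ≐-trans }
  }

module ≐-Reasoning (Γ : List Formula) = SetoidReasoning (≐-setoid Γ)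

≐-cong : ∀ c → Γ ⊢ t ≐ u → Γ ⊢ subT (single t) c ≐ subT (single u) c
≐-cong {Γ} {t} {u} c t≐u =
  subst (λ t″ → Γ ⊢ t″ ≐ subT (single u) c) (subT-single-renT-suc u c⟨t⟩)
    (≐subst (renT suc c⟨t⟩ ≐ c) t≐u
      (subst (λ t″ → Γ ⊢ t″ ≐ c⟨t⟩) (sym (subT-single-renT-suc t c⟨t⟩)) (≐refl c⟨t⟩)))
  where
  c⟨t⟩ : Term
  c⟨t⟩ = subT (single t) c

S-cong : Γ ⊢ t ≐ u → Γ ⊢ S t ≐ S u
S-cong = ≐-cong (S (var 0))

V-cong : Γ ⊢ t ≐ u → Γ ⊢ V t ≐ V u
V-cong = ≐-cong (V (var 0))

⊕-cong : Γ ⊢ t ≐ t' → Γ ⊢ u ≐ u' → Γ ⊢ t ⊕ u ≐ t' ⊕ u'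
⊕-cong {Γ} {t} {t'} {u} {u'} t≐t' u≐u' = ≐-trans left right
  where
  left : Γ ⊢ t ⊕ u ≐ t' ⊕ u
  left = subst₂ (λ a b → Γ ⊢ t ⊕ a ≐ t' ⊕ b)
           (subT-single-renT-suc t u) (subT-single-renT-suc t' u)
           (≐-cong (var 0 ⊕ renT suc u) t≐t')
  right : Γ ⊢ t' ⊕ u ≐ t' ⊕ u'
  right = subst₂ (λ a b → Γ ⊢ a ⊕ u ≐ b ⊕ u')
            (subT-single-renT-suc u t') (subT-single-renT-suc u' t')
            (≐-cong (renT suc t' ⊕ var 0) u≐u')

mulT-cong : ∀ n → Γ ⊢ t ≐ u → Γ ⊢ mulT n t ≐ mulT n u
mulT-cong zero          t≐u = t≐u
mulT-cong (suc zero)    t≐u = t≐u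
mulT-cong (suc (suc n)) t≐u = ⊕-cong (mulT-cong (suc n) t≐u) t≐u

Settles : ℕ → List Formula → Formula → Set
Settles p Γ θ = (StdTrue p θ × (Γ ⊢ θ)) ⊎ (¬ StdTrue p θ × (Γ ⊢ ¬' θ))

module _ {p : ℕ} where

  settles-¬ : Settles p Γ φ → Settles p Γ (¬' φ)
  settles-¬ (inj₁ (φ-true , ⊢φ))   = inj₂ ((λ ¬φ → ¬φ φ-true) , ¬I (weaken-∷ ⊢φ) hypothesis)
  settles-¬ (inj₂ (φ-false , ⊢¬φ)) = inj₁ (φ-false , ⊢¬φ)

  settles-∧ : Settles p Γ φ → Settles p Γ ψ → Settles p Γ (φ ∧' ψ)
  settles-∧ (inj₁ (φ-true , ⊢φ)) (inj₁ (ψ-true , ⊢ψ)) = inj₁ ((φ-true , ψ-true) , ∧I ⊢φ ⊢ψ)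
  settles-∧ (inj₂ (φ-false , ⊢¬φ)) _ = inj₂ (φ-false ∘ proj₁ , ¬I (∧E₁ hypothesis) (weaken-∷ ⊢¬φ))
  settles-∧ (inj₁ _) (inj₂ (ψ-false , ⊢¬ψ)) = inj₂ (ψ-false ∘ proj₂ , ¬I (∧E₂ hypothesis) (weaken-∷ ⊢¬ψ))

  settles-∨ : Settles p Γ φ → Settles p Γ ψ → Settles p Γ (φ ∨' ψ)
  settles-∨ (inj₁ (φ-true , ⊢φ)) _ = inj₁ (inj₁ φ-true , ∨I₁ ⊢φ)
  settles-∨ (inj₂ _) (inj₁ (ψ-true , ⊢ψ)) = inj₁ (inj₂ ψ-true , ∨I₂ ⊢ψ)
  settles-∨ (inj₂ (φ-false , ⊢¬φ)) (inj₂ (ψ-false , ⊢¬ψ)) =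
    inj₂ ( [ φ-false , ψ-false ]
         , ¬I (∨E hypothesis hypothesis (¬E hypothesis (weaken-∷ (weaken-∷ ⊢¬ψ))))
              (weaken-∷ ⊢¬φ) )

  settles-⇒ : Settles p Γ φ → Settles p Γ ψ → Settles p Γ (φ ⇒ ψ)
  settles-⇒ (inj₂ (φ-false , ⊢¬φ)) _ =
    inj₁ ((λ φ-true → contradiction φ-true φ-false) , ⇒I (¬E hypothesis (weaken-∷ ⊢¬φ)))
  settles-⇒ (inj₁ _) (inj₁ (ψ-true , ⊢ψ)) = inj₁ (const ψ-true , ⇒I (weaken-∷ ⊢ψ))
  settles-⇒ (inj₁ (φ-true , ⊢φ)) (inj₂ (ψ-false , ⊢¬ψ)) =
    inj₂ ( (λ φ→ψ → ψ-false (φ→ψ φ-true))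
         , ¬I (⇒E hypothesis (weaken-∷ ⊢φ)) (weaken-∷ ⊢¬ψ) )

ClosedT : Term → Set
ClosedT t = ∀ k → ¬ FreeT k t

module _ (p : ℕ) where

  axioms : List (Σ Formula (TBA p))
  axioms = (_ , axS0) ∷ (_ , axS1) ∷ (_ , axA0) ∷ (_ , axA1) ∷ (_ , axV0) ∷ (_ , axV2) ∷ (_ , axV3) ∷ []

  Δ : List Formula
  Δ = map proj₁ axioms

  Δ-axioms : All (TBA p) Δ
  Δ-axioms = axS0 ∷ axS1 ∷ axA0 ∷ axA1 ∷ axV0 ∷ axV2 ∷ axV3 ∷ []

  open ≐-Reasoning Δ

  S-injective : ∀ a b → Δ ⊢ S a ≐ S b ⇒ a ≐ b
  S-injective a b = subst (λ a′ → Δ ⊢ S a′ ≐ S b ⇒ a′ ≐ b) (subT-single-renT-suc b a)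
                      (∀E b (∀E a (assum (here refl))))

  0≢S : ∀ b → Δ ⊢ ¬' (zer ≐ S b)
  0≢S b = ∀E b (assum (there (here refl)))

  +-zeroʳ : ∀ a → Δ ⊢ a ⊕ zer ≐ a
  +-zeroʳ a = ∀E a (assum (there (there (here refl))))

  +-sucʳ : ∀ a b → Δ ⊢ a ⊕ S b ≐ S (a ⊕ b)
  +-sucʳ a b = subst (λ a′ → Δ ⊢ a′ ⊕ S b ≐ S (a′ ⊕ b)) (subT-single-renT-suc b a)
                 (∀E b (∀E a (assum (there (there (there (here refl)))))))

  V-zero : Δ ⊢ V zer ≐ zer
  V-zero = assum (there (there (there (there (here refl)))))

  V-mulT : ∀ t → Δ ⊢ V (mulT p t) ≐ mulT p (V t)
  V-mulT t = subst₂ (λ a b → Δ ⊢ V a ≐ b) (subT-mulT (single t) p (var 0)) (subT-mulT (single t) p (V (var 0)))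
               (∀E t (assum (there (there (there (there (there (here refl))))))))

  v3body-conjunct : ∀ t j i → 1 ≤ i → i ≤ j → Δ ⊢ v3body p j [ t ] →
                    Δ ⊢ (V (mulT p (var 0) ⊕ num i) ≐ num 1) [ t ]
  v3body-conjunct t zero          i             (s≤s _) ()
  v3body-conjunct t (suc zero)    (suc zero)    _       _           ⊢body = ⊢body
  v3body-conjunct t (suc zero)    (suc (suc _)) _       (s≤s ())
  -- A with-clause here hides from the termination checker that j + 2 descends to j + 1.
  v3body-conjunct t (suc (suc j)) i  1≤i       i≤j+2     ⊢body =
    [ (λ i<j+2 → v3body-conjunct t (suc j) i 1≤i (≤-pred i<j+2) (∧E₁ ⊢body))
    , (λ i≡j+2 → subst (λ i′ → Δ ⊢ (V (mulT p (var 0) ⊕ num i′) ≐ num 1) [ t ]) (sym i≡j+2) (∧E₂ ⊢body))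
    ]′ (m≤n⇒m<n∨m≡n i≤j+2)

  V-mulT⊕num : ∀ t i → 1 ≤ i → i < p → Δ ⊢ V (mulT p t ⊕ num i) ≐ num 1
  V-mulT⊕num t i 1≤i i<p =
    subst₂ (λ a b → Δ ⊢ V (a ⊕ b) ≐ num 1) (subT-mulT (single t) p (var 0)) (subT-num (single t) i)
      (v3body-conjunct t (p ∸ 1) i 1≤i (∸-monoˡ-≤ 1 i<p)
        (∀E t (assum (there (there (there (there (there (there (here refl))))))))))

  num⊕num : ∀ m n → Δ ⊢ num m ⊕ num n ≐ num (m + n)
  num⊕num m zero = begin
    num m ⊕ zer ≈⟨ +-zeroʳ (num m) ⟩
    num m       ≡⟨ cong num (sym (+-identityʳ m)) ⟩
    num (m + 0) ∎
  num⊕num m (suc n) = begin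
    num m ⊕ S (num n)   ≈⟨ +-sucʳ (num m) (num n) ⟩
    S (num m ⊕ num n)   ≈⟨ S-cong (num⊕num m n) ⟩
    num (suc (m + n))   ≡⟨ cong num (sym (+-suc m n)) ⟩
    num (m + suc n)     ∎

  mulT-num : ∀ n m → .{{NonZero n}} → Δ ⊢ mulT n (num m) ≐ num (n * m)
  mulT-num (suc zero) m = begin
    num m       ≡⟨ cong num (sym (+-identityʳ m)) ⟩
    num (m + 0) ∎
  mulT-num (suc (suc n)) m = begin
    mulT (suc n) (num m) ⊕ num m ≈⟨ ⊕-cong (mulT-num (suc n) m) (≐refl (num m)) ⟩
    num (suc n * m) ⊕ num m      ≈⟨ num⊕num (suc n * m) m ⟩
    num (suc n * m + m)          ≡⟨ cong num (+-comm (suc n * m) m) ⟩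
    num (m + suc n * m)          ∎

  num-≢ : ∀ {m n} → m ≢ n → Δ ⊢ ¬' (num m ≐ num n)
  num-≢ {zero}  {zero}  0≢0 = contradiction refl 0≢0
  num-≢ {zero}  {suc n} _   = 0≢S (num n)
  num-≢ {suc m} {zero}  _   = ¬I (≐-sym hypothesis) (weaken-∷ (0≢S (num m)))
  num-≢ {suc m} {suc n} m+1≢n+1 =
    ¬I (⇒E (weaken-∷ (S-injective (num m) (num n))) hypothesis)
       (weaken-∷ (num-≢ (m+1≢n+1 ∘ cong suc)))

  module _ (1<p : 1 < p) where

    private instance
      p≢0 : NonZero p
      p≢0 = >-nonZero (<-trans (s≤s z≤n) 1<p)

    mulT⊕num : ∀ q r → Δ ⊢ mulT p (num q) ⊕ num r ≐ num (r + q * p)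
    mulT⊕num q r = begin
      mulT p (num q) ⊕ num r ≈⟨ ⊕-cong (mulT-num p q) (≐refl (num r)) ⟩
      num (p * q) ⊕ num r    ≈⟨ num⊕num (p * q) r ⟩
      num (p * q + r)        ≡⟨ cong num (trans (+-comm (p * q) r) (cong (r +_) (*-comm p q))) ⟩
      num (r + q * p)        ∎

    -- The case split is that of vpAux, so that its value reduces in each branch.
    V-num-fuel : ∀ fuel n → n < fuel → Δ ⊢ V (num n) ≐ num (vpAux p fuel n)
    V-num-fuel (suc fuel) n n<fuel with n ≟ 0
    ... | yes refl = V-zero
    ... | no n≢0 with p ∣? n
    ...   | yes (divides q n≡q*p) = begin
            V (num n)                     ≡⟨ cong (V ∘ num) n≡q*p ⟩
            V (num (0 + q * p))           ≈⟨ V-cong (≐-sym (mulT⊕num q 0)) ⟩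
            V (mulT p (num q) ⊕ zer)      ≈⟨ V-cong (+-zeroʳ (mulT p (num q))) ⟩
            V (mulT p (num q))            ≈⟨ V-mulT (num q) ⟩
            mulT p (V (num q))            ≈⟨ mulT-cong p (V-num-fuel fuel q q<fuel) ⟩
            mulT p (num (vpAux p fuel q)) ≈⟨ mulT-num p (vpAux p fuel q) ⟩
            num (p * vpAux p fuel q)      ∎
      where
      q<n : q < n
      q<n = subst (q <_) (sym n≡q*p)
              (m<m*n q p {{≢-nonZero (λ q≡0 → n≢0 (trans n≡q*p (cong (_* p) q≡0)))}} 1<p)
      q<fuel : q < fuel
      q<fuel = <-≤-trans q<n (≤-pred n<fuel)
    ...   | no p∤n = begin
            V (num n)                           ≡⟨ cong (V ∘ num) n≡r+q*p ⟩
            V (num (n % p + n / p * p))         ≈⟨ V-cong (≐-sym (mulT⊕num (n / p) (n % p))) ⟩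
            V (mulT p (num (n / p)) ⊕ num (n % p)) ≈⟨ V-mulT⊕num (num (n / p)) (n % p) 1≤r (m%n<n n p) ⟩
            num 1                               ∎
      where
      n≡r+q*p : n ≡ n % p + n / p * p
      n≡r+q*p = m≡m%n+[m/n]*n n p
      1≤r : 1 ≤ n % p
      1≤r = n≢0⇒n>0 (λ r≡0 → p∤n (divides (n / p) (trans n≡r+q*p (cong (_+ n / p * p) r≡0))))

    V-num : ∀ n → Δ ⊢ V (num n) ≐ num (vp p n)
    V-num n = V-num-fuel (suc n) n ≤-refl

    eval-closed : ∀ ρ t → ClosedT t → Δ ⊢ t ≐ num (evalT p ρ t)
    eval-closed ρ (var n) closed = ⊥-elim (closed n fvar)
    eval-closed ρ zer     closed = ≐refl zer
    eval-closed ρ (S t)   closed = S-cong (eval-closed ρ t (λ k → closed k ∘ fS))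
    eval-closed ρ (t ⊕ u) closed = begin
      t ⊕ u                                 ≈⟨ ⊕-cong (eval-closed ρ t (λ k → closed k ∘ f⊕ˡ))
                                                      (eval-closed ρ u (λ k → closed k ∘ f⊕ʳ)) ⟩
      num (evalT p ρ t) ⊕ num (evalT p ρ u) ≈⟨ num⊕num (evalT p ρ t) (evalT p ρ u) ⟩
      num (evalT p ρ t + evalT p ρ u)       ∎
    eval-closed ρ (V t)   closed = begin
      V t                     ≈⟨ V-cong (eval-closed ρ t (λ k → closed k ∘ fV)) ⟩
      V (num (evalT p ρ t))   ≈⟨ V-num (evalT p ρ t) ⟩
      num (vp p (evalT p ρ t)) ∎

    private
      ⟦_⟧ : Term → ℕ
      ⟦ t ⟧ = evalT p (λ _ → 0) t

    settles-≐ : ClosedT t → ClosedT u → Settles p Δ (t ≐ u)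
    settles-≐ {t} {u} t-closed u-closed = decide (⟦ t ⟧ ≟ ⟦ u ⟧)
      where
      ⊢t≐⟦t⟧ : Δ ⊢ t ≐ num ⟦ t ⟧
      ⊢t≐⟦t⟧ = eval-closed (λ _ → 0) t t-closed
      ⊢u≐⟦u⟧ : Δ ⊢ u ≐ num ⟦ u ⟧
      ⊢u≐⟦u⟧ = eval-closed (λ _ → 0) u u-closed
      decide : Dec (⟦ t ⟧ ≡ ⟦ u ⟧) → Settles p Δ (t ≐ u)
      decide (yes t≡u) = inj₁ (t≡u , (begin
        t         ≈⟨ ⊢t≐⟦t⟧ ⟩
        num ⟦ t ⟧ ≡⟨ cong num t≡u ⟩
        num ⟦ u ⟧ ≈⟨ ≐-sym ⊢u≐⟦u⟧ ⟩
        u         ∎))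
      decide (no t≢u) = inj₂ (t≢u , ¬I (≐-trans (≐-sym (weaken-∷ ⊢t≐⟦t⟧))
                                               (≐-trans hypothesis (weaken-∷ ⊢u≐⟦u⟧)))
                                      (weaken-∷ (num-≢ t≢u)))

    settles-QF : ∀ {θ} → QF θ → Sentence θ → Settles p Δ θ
    settles-QF qf≐       closed = settles-≐ (λ k → closed k ∘ f≐ˡ) (λ k → closed k ∘ f≐ʳ)
    settles-QF (qf¬ q)   closed = settles-¬ (settles-QF q (λ k → closed k ∘ f¬))
    settles-QF (qf∧ q r) closed = settles-∧ (settles-QF q (λ k → closed k ∘ f∧ˡ)) (settles-QF r (λ k → closed k ∘ f∧ʳ))
    settles-QF (qf∨ q r) closed = settles-∨ (settles-QF q (λ k → closed k ∘ f∨ˡ)) (settles-QF r (λ k → closed k ∘ f∨ʳ))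
    settles-QF (qf⇒ q r) closed = settles-⇒ (settles-QF q (λ k → closed k ∘ f⇒ˡ)) (settles-QF r (λ k → closed k ∘ f⇒ʳ))

lemma3 : (p : ℕ) → 2 ≤ p → (θ : Formula) → QF θ → Sentence θ →
           (StdTrue p θ → TBA p ⊩ θ) × (¬ StdTrue p θ → TBA p ⊩ (¬' θ))
lemma3 p 2≤p θ qf closed with settles-QF p 2≤p qf closed
... | inj₁ (θ-true , ⊢θ)   = (λ _ → Δ p , Δ-axioms p , ⊢θ) , (λ θ-false → contradiction θ-true θ-false)
... | inj₂ (θ-false , ⊢¬θ) = (λ θ-true → contradiction θ-true θ-false) , (λ _ → Δ p , Δ-axioms p , ⊢¬θ)
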